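{- Let $n\ge 71$ and let $D$ be a minimal dominating set of $G_n\times G_n$ with $|D|>n^2$ such that $D_{00}$, $D_{10}$, $D_{01}$ are nonempty and $D_{11}$ is empty. Then at least $n^2-10n$ members of $D$ lie in $D_{00}$ and have a private neighbor (with respect to $D$) in $N_{11}$. Moreover, no vertex of $N_{00}$ is a private neighbor (with respect to $D$) of a vertex of $D$.
   Context: $G_n=K_2\,\square\,K_n$ is identified with vertex set $\mathbb{Z}_2\times\mathbb{Z}_n$, where $(a,b)$ and $(a',b')$ are adjacent iff exactly one of $a=a'$, $b=b'$ holds. The direct product $G\times H$ has vertex set $V(G)\times V(H)$, with $(u_G,u_H)$ adjacent to $(v_G,v_H)$ iff $u_Gv_G\in E(G)$ and $u_Hv_H\in E(H)$; so vertices of $G_n\times G_n$ are $4$-tuples $(a,b,c,d)\in\mathbb{Z}_2\times\mathbb{Z}_n\times\mathbb{Z}_2\times\mathbb{Z}_n$. For $i,j\in\{0,1\}$ let $N_{ij}=\{i\}\times\mathbb{Z}_n\times\{j\}\times\mathbb{Z}_n$ and $D_{ij}=D\cap N_{ij}$. A set $D$ is dominating if every vertex is in $D$ or adjacent to a vertex of $D$, and minimal if no proper subset is dominating. For $v\in D$, a vertex $u$ is a private neighbor of $v$ with respect to $D$ if $u\in N[v]$ and $u\notin N[D\setminus\{v\}]$, where $N[\cdot]$ denotes closed neighborhood (a vertex may be its own private neighbor). -}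

module Defs where

open import Data.Nat using (ℕ)
open import Data.Fin using (Fin)
open import Data.Bool using (Bool; true; false)
open import Data.Product using (_×_; _,_; ∃-syntax; Σ-syntax)
open import Data.Sum using (_⊎_)
open import Data.List using (List; length; filter; allFin; concatMap; map)
open import Relation.Binary.PropositionalEquality using (_≡_; _≢_)
open import Relation.Nullary using (¬_)
open import Relation.Binary.Definitions using (DecidableEquality)
open import Relation.Nullary using (does)
open import Data.Product.Properties using (≡-dec)
import Data.Fin as F
open import Data.Bool using (if_then_else_)
open import Data.List using (cartesianProduct; filterᵇ)

-- Vertices of G_n = K_2 □ K_n : Z_2 × Z_n
VG : ℕ → Set
VG n = Fin 2 × Fin n

AdjG : ∀ {n} → VG n → VG n → Set
AdjG (a , b) (a' , b') = (a ≡ a' × b ≢ b') ⊎ (a ≢ a' × b ≡ b')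

V : ℕ → Set
V n = Fin 2 × Fin n × Fin 2 × Fin n

Adj : ∀ {n} → V n → V n → Set
Adj (a , b , c , d) (a' , b' , c' , d') =
  AdjG (a , b) (a' , b') × AdjG (c , d) (c' , d')

InClosedNbhd : ∀ {n} → V n → V n → Set
InClosedNbhd v u = u ≡ v ⊎ Adj v u

-- Sets of vertices are Boolean-valued (hence decidable, finite) subsets
VSet : ℕ → Set
VSet n = V n → Bool

_∈ₛ_ : ∀ {n} → V n → VSet n → Set
v ∈ₛ D = D v ≡ true

_⊆ₛ_ : ∀ {n} → VSet n → VSet n → Set
S ⊆ₛ D = ∀ v → v ∈ₛ S → v ∈ₛ D

InNbhdSet : ∀ {n} → VSet n → V n → Set
InNbhdSet S u = ∃[ v ] (v ∈ₛ S × InClosedNbhd v u)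

Dominating : ∀ {n} → VSet n → Set
Dominating {n} D = ∀ (u : V n) → InNbhdSet D u

MinimalDominating : ∀ {n} → VSet n → Set
MinimalDominating {n} D =
  Dominating D ×
  (∀ (S : VSet n) → S ⊆ₛ D → Dominating S → D ⊆ₛ S)

_≟V_ : ∀ {n} → DecidableEquality (V n)
_≟V_ = ≡-dec F._≟_ (≡-dec F._≟_ (≡-dec F._≟_ F._≟_))

remove : ∀ {n} → VSet n → V n → VSet n
remove D v u = if does (u ≟V v) then false else D u

PrivateNeighbor : ∀ {n} → VSet n → V n → V n → Set
PrivateNeighbor D v u = InClosedNbhd v u × ¬ InNbhdSet (remove D v) u

allV : (n : ℕ) → List (V n)
allV n = cartesianProduct (allFin 2)
          (cartesianProduct (allFin n) (cartesianProduct (allFin 2) (allFin n)))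

card : ∀ {n} → VSet n → ℕ
card {n} D = length (filterᵇ D (allV n))

InN : ∀ {n} → Fin 2 → Fin 2 → V n → Set
InN i j (a , b , c , d) = a ≡ i × c ≡ j

NonemptyPart : ∀ {n} → VSet n → Fin 2 → Fin 2 → Set
NonemptyPart D i j = ∃[ v ] (v ∈ₛ D × InN i j v)

-- By minimality every vertex v = (a, b, c, d) of D has a private neighbor u, and the layer
-- of u says where v sits inside its part D_ac.  If u lies in N_ac itself, every other vertex
-- of D_ac shares the b- or d-coordinate of u, so |D_ac| ≤ 2n + 1.  If the layer of u differs
-- from N_ac in one coordinate, the b-line (resp. d-line) of D_ac through v has at most two
-- points.  Otherwise u = (ā, b, c̄, d), and any vertex (ā, r, c̄, s) of D forces b = r or d = s.
-- Points on such sparse lines number at most 2n per direction and a single line holds at most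
-- n points, which gives |D_10|, |D_01| ≤ 6n, hence |D_00| > 2n + 1.  That rules out private
-- neighbors in N_00 and improves the bounds to 3n; at most 4n vertices of D_00 lie on a
-- sparse line, and every other vertex of D_00 has its private neighbor in N_11.
module Submission where

open import Defs
open import Data.Bool using (Bool; true; false; _∧_; _∨_; not)
open import Data.Bool.Properties using (∨-zeroʳ; T-≡) renaming (_≟_ to _≟ᵇ_)
open import Data.Fin as Fin using (Fin; zero; suc)
open import Data.List using (List; []; _∷_; length; filterᵇ; allFin)
open import Data.List.Membership.Propositional using (_∈_; lose)
open import Data.List.Membership.Propositional.Properties using (∈-allFin; ∈-cartesianProduct⁺)
open import Data.List.Properties using (length-tabulate)
open import Data.List.Relation.Unary.All as All using (All; []; _∷_; all?)
open import Data.List.Relation.Unary.All.Properties using (all-filter; ¬All⇒Any¬)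
open import Data.List.Relation.Unary.Any using (here; there; any?; satisfied)
open import Data.List.Relation.Unary.AllPairs using ([]; _∷_)
open import Data.List.Relation.Unary.Unique.Propositional using (Unique)
open import Data.List.Relation.Unary.Unique.Propositional.Properties
  using (allFin⁺; cartesianProduct⁺; filter⁺)
open import Data.Nat using (ℕ; zero; suc; _+_; _*_; _∸_; _≤_; _<_; _>_; z≤n; s≤s; _≤?_)
open import Data.Nat.Properties
open import Data.Nat.Tactic.RingSolver using (solve-∀)
open import Data.Product using (_×_; _,_; ∃-syntax; proj₁; proj₂)
open import Data.Sum as Sum using (_⊎_; inj₁; inj₂)
open import Function using (_∘_; id)
open import Function.Bundles using (Equivalence)
open import Relation.Binary.PropositionalEquality using (_≡_; _≢_; refl; sym; trans; cong; subst)
open import Relation.Nullary using (¬_; Dec; yes; no; does; contradiction)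
open import Relation.Nullary.Decidable using (dec-true; _×-dec_; _⊎-dec_; ¬?; T?)

variable
  n m : ℕ

-- Counting in filtered lists

module _ {A : Set} where

  length-filterᵇ-mono : ∀ {P Q : A → Bool} → (∀ x → P x ≡ true → Q x ≡ true) →
    ∀ xs → length (filterᵇ P xs) ≤ length (filterᵇ Q xs)
  length-filterᵇ-mono h [] = z≤n
  length-filterᵇ-mono {P} {Q} h (x ∷ xs) with P x in px | Q x in qx
  ... | true  | true  = s≤s (length-filterᵇ-mono h xs)
  ... | true  | false with () ← trans (sym (h x px)) qx
  ... | false | true  = m≤n⇒m≤1+n (length-filterᵇ-mono h xs)
  ... | false | false = length-filterᵇ-mono h xs

  length-filterᵇ-∨ : ∀ (P Q : A → Bool) xs →
    length (filterᵇ (λ x → P x ∨ Q x) xs) ≤ length (filterᵇ P xs) + length (filterᵇ Q xs)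
  length-filterᵇ-∨ P Q [] = z≤n
  length-filterᵇ-∨ P Q (x ∷ xs) with ih ← length-filterᵇ-∨ P Q xs | P x | Q x
  ... | true  | true  = s≤s (≤-trans ih (+-monoʳ-≤ _ (n≤1+n _)))
  ... | true  | false = s≤s ih
  ... | false | true  = ≤-trans (s≤s ih) (≤-reflexive (sym (+-suc _ _)))
  ... | false | false = ih

  length-filterᵇ-none : ∀ (P : A → Bool) {xs} → All (λ x → ¬ P x ≡ true) xs →
    length (filterᵇ P xs) ≡ 0
  length-filterᵇ-none P [] = refl
  length-filterᵇ-none P {x ∷ _} (¬px ∷ ¬pxs) with P x
  ... | true  = contradiction refl ¬px
  ... | false = length-filterᵇ-none P ¬pxs

  length-filterᵇ-≤1 : ∀ (P : A → Bool) {xs} → Unique xs →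
    (∀ {x y} → P x ≡ true → P y ≡ true → x ≡ y) → length (filterᵇ P xs) ≤ 1
  length-filterᵇ-≤1 P [] _ = z≤n
  length-filterᵇ-≤1 P {x ∷ _} (x∉xs ∷ unique) h with P x in px
  ... | true  = s≤s (≤-reflexive (length-filterᵇ-none P (All.map (λ x≢y py → x≢y (h px py)) x∉xs)))
  ... | false = length-filterᵇ-≤1 P unique h

  filterᵇ-nonempty : ∀ (P : A → Bool) xs → 1 ≤ length (filterᵇ P xs) → ∃[ x ] P x ≡ true
  filterᵇ-nonempty P (x ∷ xs) h with P x in px
  ... | true  = x , px
  ... | false = filterᵇ-nonempty P xs h

∈-allV : (v : V n) → v ∈ allV n
∈-allV (a , b , c , d) =
  ∈-cartesianProduct⁺ (∈-allFin a) (∈-cartesianProduct⁺ (∈-allFin b)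
    (∈-cartesianProduct⁺ (∈-allFin c) (∈-allFin d)))

allV-unique : ∀ n → Unique (allV n)
allV-unique n =
  cartesianProduct⁺ (allFin⁺ 2) (cartesianProduct⁺ (allFin⁺ n)
    (cartesianProduct⁺ (allFin⁺ 2) (allFin⁺ n)))

-- Vertex sets

infixr 27 _∩_
infixr 26 _∪_

-- Opaque, so that unification can recover S and T from a goal v ∈ₛ S ∩ T instead of
-- facing a stuck Boolean conjunction.
opaque

  ∅ : VSet n
  ∅ _ = false

  _∩_ _∪_ : VSet n → VSet n → VSet n
  (S ∩ T) v = S v ∧ T v
  (S ∪ T) v = S v ∨ T v

  ∁ : VSet n → VSet n
  ∁ S v = not (S v)

  ⟦_⟧ : {P : V n → Set} → (∀ v → Dec (P v)) → VSet n
  ⟦ P? ⟧ v = does (P? v)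

variable
  S T : VSet n
  v w : V n

opaque
  unfolding ∅ _∩_ _∪_ ∁ ⟦_⟧

  ∉∅ : ¬ v ∈ₛ ∅
  ∉∅ ()

  ∈-∩⁺ : v ∈ₛ S → v ∈ₛ T → v ∈ₛ S ∩ T
  ∈-∩⁺ p q rewrite p | q = refl

  ∈-∩⁻ : v ∈ₛ S ∩ T → v ∈ₛ S × v ∈ₛ T
  ∈-∩⁻ {v = v} {S = S} p with S v
  ... | true = refl , p

  ∈-∪⁺ˡ : v ∈ₛ S → v ∈ₛ S ∪ T
  ∈-∪⁺ˡ p rewrite p = refl

  ∈-∪⁺ʳ : v ∈ₛ T → v ∈ₛ S ∪ T
  ∈-∪⁺ʳ {v = v} {S = S} p rewrite p = ∨-zeroʳ (S v)

  ∈-∁⁻ : v ∈ₛ ∁ S → ¬ v ∈ₛ S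
  ∈-∁⁻ p q rewrite q with () ← p

  _∈?_ : (v : V n) (S : VSet n) → v ∈ₛ S ⊎ v ∈ₛ ∁ S
  v ∈? S with S v
  ... | true  = inj₁ refl
  ... | false = inj₂ refl

  ∈-⟦⟧⁺ : {P : V n → Set} (P? : ∀ v → Dec (P v)) → P v → v ∈ₛ ⟦ P? ⟧
  ∈-⟦⟧⁺ {v = v} P? = dec-true (P? v)

  ∈-⟦⟧⁻ : {P : V n → Set} (P? : ∀ v → Dec (P v)) → v ∈ₛ ⟦ P? ⟧ → P v
  ∈-⟦⟧⁻ {v = v} P? p with P? v | p
  ... | yes pv | _ = pv

∉-⟦⟧⁻ : {P : V n → Set} (P? : ∀ v → Dec (P v)) → v ∈ₛ ∁ ⟦ P? ⟧ → ¬ P v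
∉-⟦⟧⁻ P? p = ∈-∁⁻ p ∘ ∈-⟦⟧⁺ P?

｛_｝ : V n → VSet n
｛ v ｝ = ⟦ (_≟V v) ⟧

line : (V n → Fin n) → Fin n → VSet n
line key i = ⟦ (λ w → key w Fin.≟ i) ⟧

∈-line⁺ : ∀ (key : V n → Fin n) {i} → key v ≡ i → v ∈ₛ line key i
∈-line⁺ key {i} = ∈-⟦⟧⁺ (λ w → key w Fin.≟ i)

∈-line⁻ : ∀ (key : V n → Fin n) {i} → v ∈ₛ line key i → key v ≡ i
∈-line⁻ key {i} = ∈-⟦⟧⁻ (λ w → key w Fin.≟ i)

∉-line⁻ : ∀ (key : V n → Fin n) {i} → v ∈ₛ ∁ (line key i) → key v ≢ i
∉-line⁻ key {i} = ∉-⟦⟧⁻ (λ w → key w Fin.≟ i)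

InN? : ∀ i j (v : V n) → Dec (InN i j v)
InN? i j (a , _ , c , _) = (a Fin.≟ i) ×-dec (c Fin.≟ j)

part : VSet n → Fin 2 → Fin 2 → VSet n
part D i j = D ∩ ⟦ InN? i j ⟧

∈-part⁺ : ∀ {D : VSet n} {i j} → v ∈ₛ D → InN i j v → v ∈ₛ part D i j
∈-part⁺ {i = i} {j} p q = ∈-∩⁺ p (∈-⟦⟧⁺ (InN? i j) q)

∈-part⁻ : ∀ {D : VSet n} {i j} → v ∈ₛ part D i j → v ∈ₛ D × InN i j v
∈-part⁻ {i = i} {j} p with p₁ , p₂ ← ∈-∩⁻ p = p₁ , ∈-⟦⟧⁻ (InN? i j) p₂

⋃ : {I : Set} → List I → (I → VSet n) → VSet n
⋃ []       F = ∅
⋃ (i ∷ is) F = F i ∪ ⋃ is F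

∈-⋃⁺ : ∀ {I : Set} {is : List I} {F : I → VSet n} {i} → i ∈ is → v ∈ₛ F i → v ∈ₛ ⋃ is F
∈-⋃⁺ (here refl)  p = ∈-∪⁺ˡ p
∈-⋃⁺ (there i∈is) p = ∈-∪⁺ʳ (∈-⋃⁺ i∈is p)

-- Cardinality

-- card, made opaque for the same reason as the set operations: a bound on ∣ S ∣ then
-- determines S.
opaque

  ∣_∣ : VSet n → ℕ
  ∣_∣ = card

opaque
  unfolding ∣_∣ _∪_

  ∣∣≡card : ∀ (S : VSet n) → ∣ S ∣ ≡ card S
  ∣∣≡card S = refl

  card-mono : S ⊆ₛ T → ∣ S ∣ ≤ ∣ T ∣
  card-mono {n} h = length-filterᵇ-mono h (allV n)

  card-∪ : ∀ {m₁ m₂} → ∣ S ∣ ≤ m₁ → ∣ T ∣ ≤ m₂ → ∣ S ∪ T ∣ ≤ m₁ + m₂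
  card-∪ {n} {S} {T} p q = ≤-trans (length-filterᵇ-∨ S T (allV n)) (+-mono-≤ p q)

  card-subsingleton : (∀ {v w} → v ∈ₛ S → w ∈ₛ S → v ≡ w) → ∣ S ∣ ≤ 1
  card-subsingleton {n} {S} = length-filterᵇ-≤1 S (allV-unique n)

  card-empty : (∀ v → ¬ v ∈ₛ S) → ∣ S ∣ ≡ 0
  card-empty {n} {S} h = length-filterᵇ-none S (All.universal h (allV n))

  card-nonempty : 1 ≤ ∣ S ∣ → ∃[ v ] v ∈ₛ S
  card-nonempty {n} {S} = filterᵇ-nonempty S (allV n)

card-singleton : (v : V n) → ∣ ｛ v ｝ ∣ ≤ 1
card-singleton v = card-subsingleton λ p q → trans (∈-⟦⟧⁻ (_≟V v) p) (sym (∈-⟦⟧⁻ (_≟V v) q))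

card-pair : ∀ x y → (∀ w → w ∈ₛ S → w ≡ x ⊎ w ≡ y) → ∣ S ∣ ≤ 2
card-pair {S = S} x y h = ≤-trans (card-mono cover) (card-∪ (card-singleton x) (card-singleton y))
  where
  cover : S ⊆ₛ ｛ x ｝ ∪ ｛ y ｝
  cover w w∈S with h w w∈S
  ... | inj₁ refl = ∈-∪⁺ˡ (∈-⟦⟧⁺ (_≟V x) refl)
  ... | inj₂ refl = ∈-∪⁺ʳ (∈-⟦⟧⁺ (_≟V y) refl)

card-⋃ : ∀ {I : Set} (F : I → VSet n) is → (∀ i → ∣ F i ∣ ≤ m) → ∣ ⋃ is F ∣ ≤ length is * m
card-⋃ F []       _ = ≤-reflexive (card-empty λ v → ∉∅ {v = v})
card-⋃ F (i ∷ is) h = card-∪ (h i) (card-⋃ F is h)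

card-fibres : (key : V n → Fin n) → (∀ i → ∣ S ∩ line key i ∣ ≤ m) → ∣ S ∣ ≤ n * m
card-fibres {n} {S} {m} key h = begin
  ∣ S ∣                                   ≤⟨ card-mono (λ v v∈S → ∈-⋃⁺ (∈-allFin (key v)) (∈-∩⁺ v∈S (∈-line⁺ key refl))) ⟩
  ∣ ⋃ (allFin n) (λ i → S ∩ line key i) ∣ ≤⟨ card-⋃ _ (allFin n) h ⟩
  length (allFin n) * m                   ≡⟨ cong (_* m) (length-tabulate {n = n} id) ⟩
  n * m                                   ∎
  where open ≤-Reasoning

JointlyInjective : VSet n → (V n → Fin n) → (V n → Fin n) → Set
JointlyInjective S k₁ k₂ = ∀ {v w} → v ∈ₛ S → w ∈ₛ S → k₁ v ≡ k₁ w → k₂ v ≡ k₂ w → v ≡ w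

swap-injective : ∀ {k₁ k₂ : V n → Fin n} → JointlyInjective S k₁ k₂ → JointlyInjective S k₂ k₁
swap-injective inj p q e₂ e₁ = inj p q e₁ e₂

card-line-constant : ∀ {k₁ k₂ : V n → Fin n} {i j} → JointlyInjective S k₁ k₂ →
  (∀ w → w ∈ₛ S ∩ line k₁ i → k₂ w ≡ j) → ∣ S ∩ line k₁ i ∣ ≤ 1
card-line-constant {k₁ = k₁} inj const = card-subsingleton λ {v} {w} p q →
  inj (proj₁ (∈-∩⁻ p)) (proj₁ (∈-∩⁻ q))
      (trans (∈-line⁻ k₁ (proj₂ (∈-∩⁻ p))) (sym (∈-line⁻ k₁ (proj₂ (∈-∩⁻ q)))))
      (trans (const v p) (sym (const w q)))

card-line : ∀ {k₁ k₂ : V n → Fin n} → JointlyInjective S k₁ k₂ → ∀ i → ∣ S ∩ line k₁ i ∣ ≤ n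
card-line {n} {S} {k₁} {k₂} inj i =
  ≤-trans (card-fibres k₂ λ j → card-line-constant (swap-injective inj-on-line) on-line)
          (≤-reflexive (*-identityʳ n))
  where
  inj-on-line : JointlyInjective (S ∩ line k₁ i) k₁ k₂
  inj-on-line p q = inj (proj₁ (∈-∩⁻ p)) (proj₁ (∈-∩⁻ q))

  on-line : ∀ {j} w → w ∈ₛ (S ∩ line k₁ i) ∩ line k₂ j → k₁ w ≡ i
  on-line w p = ∈-line⁻ k₁ (proj₂ (∈-∩⁻ (proj₁ (∈-∩⁻ p))))

Sparse : VSet n → (V n → Fin n) → Fin n → Set
Sparse S key i = ∣ S ∩ line key i ∣ ≤ 2

sparse? : (S : VSet n) (key : V n → Fin n) (i : Fin n) → Dec (Sparse S key i)
sparse? S key i = ∣ S ∩ line key i ∣ ≤? 2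

sparsePart : VSet n → (V n → Fin n) → VSet n
sparsePart S key = S ∩ ⟦ (λ w → sparse? S key (key w)) ⟧

∈-sparsePart⁺ : ∀ {key : V n → Fin n} → v ∈ₛ S → Sparse S key (key v) → v ∈ₛ sparsePart S key
∈-sparsePart⁺ {S = S} {key} v∈S sparse = ∈-∩⁺ v∈S (∈-⟦⟧⁺ (λ w → sparse? S key (key w)) sparse)

∈-sparsePart⁻ : ∀ {key : V n → Fin n} → v ∈ₛ sparsePart S key → Sparse S key (key v)
∈-sparsePart⁻ {S = S} {key} p = ∈-⟦⟧⁻ (λ w → sparse? S key (key w)) (proj₂ (∈-∩⁻ p))

card-sparsePart : (S : VSet n) (key : V n → Fin n) → ∣ sparsePart S key ∣ ≤ n * 2
card-sparsePart S key = card-fibres key fibre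
  where
  fibre : ∀ i → ∣ sparsePart S key ∩ line key i ∣ ≤ 2
  fibre i with sparse? S key i
  ... | yes sparse = ≤-trans (card-mono on-line) sparse
    where
    on-line : sparsePart S key ∩ line key i ⊆ₛ S ∩ line key i
    on-line w p with w∈sparse , w∈line ← ∈-∩⁻ p = ∈-∩⁺ (proj₁ (∈-∩⁻ w∈sparse)) w∈line
  ... | no dense = ≤-trans (≤-reflexive (card-empty empty)) z≤n
    where
    empty : ∀ w → ¬ w ∈ₛ sparsePart S key ∩ line key i
    empty w p with w∈sparse , w∈line ← ∈-∩⁻ p with refl ← ∈-line⁻ key w∈line
      = dense (∈-sparsePart⁻ w∈sparse)

small⇒≤3n : 1 ≤ n → m ≤ 1 + (n + n) → m ≤ 3 * n
small⇒≤3n {n} 1≤n small = ≤-trans small (≤-trans (+-monoˡ-≤ (n + n) 1≤n) (≤-reflexive (3n n)))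
  where
  3n : ∀ n → n + (n + n) ≡ 3 * n
  3n = solve-∀

card-≤6n : ∀ {k₁ k₂ : V n → Fin n} {t₁ t₂} → JointlyInjective S k₁ k₂ → 1 ≤ n →
  (∀ v → v ∈ₛ S →
    ∣ S ∣ ≤ 1 + (n + n) ⊎ Sparse S k₁ (k₁ v) ⊎ Sparse S k₂ (k₂ v) ⊎ k₁ v ≡ t₁ ⊎ k₂ v ≡ t₂) →
  ∣ S ∣ ≤ 6 * n
card-≤6n {n} {S} {k₁} {k₂} {t₁} {t₂} inj 1≤n cases with ∣ S ∣ ≤? 1 + (n + n)
... | yes small = ≤-trans (small⇒≤3n 1≤n small) (*-monoˡ-≤ n (m≤m+n 3 3))
... | no large = begin
  ∣ S ∣                                   ≤⟨ card-mono cover ⟩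
  ∣ sparsePart S k₁ ∪ sparsePart S k₂ ∪ (S ∩ line k₁ t₁) ∪ (S ∩ line k₂ t₂) ∣
    ≤⟨ card-∪ (card-sparsePart S k₁) (card-∪ (card-sparsePart S k₂)
         (card-∪ (card-line inj t₁) (card-line (swap-injective inj) t₂))) ⟩
  n * 2 + (n * 2 + (n + n))               ≡⟨ 6n n ⟩
  6 * n                                   ∎
  where
  open ≤-Reasoning
  6n : ∀ n → n * 2 + (n * 2 + (n + n)) ≡ 6 * n
  6n = solve-∀

  cover : S ⊆ₛ sparsePart S k₁ ∪ sparsePart S k₂ ∪ (S ∩ line k₁ t₁) ∪ (S ∩ line k₂ t₂)
  cover v v∈S with cases v v∈S
  ... | inj₁ small                  = contradiction small large
  ... | inj₂ (inj₁ sparse)          = ∈-∪⁺ˡ (∈-sparsePart⁺ v∈S sparse)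
  ... | inj₂ (inj₂ (inj₁ sparse))   = ∈-∪⁺ʳ (∈-∪⁺ˡ (∈-sparsePart⁺ v∈S sparse))
  ... | inj₂ (inj₂ (inj₂ (inj₁ e))) = ∈-∪⁺ʳ (∈-∪⁺ʳ (∈-∪⁺ˡ (∈-∩⁺ v∈S (∈-line⁺ k₁ e))))
  ... | inj₂ (inj₂ (inj₂ (inj₂ e))) = ∈-∪⁺ʳ (∈-∪⁺ʳ (∈-∪⁺ʳ (∈-∩⁺ v∈S (∈-line⁺ k₂ e))))

card-≤3n : ∀ {k₁ k₂ : V n → Fin n} {t₁ t₂} → JointlyInjective S k₁ k₂ → 1 ≤ n →
  (∀ v → v ∈ₛ S → ∣ S ∣ ≤ 1 + (n + n) ⊎ Sparse S k₁ (k₁ v) ⊎ k₁ v ≡ t₁ ⊎ k₂ v ≡ t₂) →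
  ∣ S ∣ ≤ 3 * n
card-≤3n {n} {S} {k₁} {k₂} {t₁} {t₂} inj 1≤n cases with ∣ S ∣ ≤? 1 + (n + n)
... | yes small = small⇒≤3n 1≤n small
... | no large = begin
  ∣ S ∣                                   ≤⟨ card-mono cover ⟩
  ∣ sparsePart S k₁ ∪ (S ∩ line k₁ t₁) ∣  ≤⟨ card-∪ (card-sparsePart S k₁) (card-line inj t₁) ⟩
  n * 2 + n                               ≡⟨ 3n n ⟩
  3 * n                                   ∎
  where
  open ≤-Reasoning
  3n : ∀ n → n * 2 + n ≡ 3 * n
  3n = solve-∀

  -- A dense k₁-line other than t₁ would lie inside the k₂-line t₂, so it would have at
  -- most one point.
  dense⇒on-t₁ : v ∈ₛ S → ¬ Sparse S k₁ (k₁ v) → k₁ v ≡ t₁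
  dense⇒on-t₁ {v} v∈S dense with k₁ v Fin.≟ t₁
  ... | yes on-t₁ = on-t₁
  ... | no off-t₁ = contradiction (≤-trans (card-line-constant inj on-t₂) (n≤1+n 1)) dense
    where
    on-t₂ : ∀ w → w ∈ₛ S ∩ line k₁ (k₁ v) → k₂ w ≡ t₂
    on-t₂ w p with w∈S , w∈line ← ∈-∩⁻ p with same-line ← ∈-line⁻ k₁ w∈line with cases w w∈S
    ... | inj₁ small           = contradiction small large
    ... | inj₂ (inj₁ sparse)   = contradiction (subst (Sparse S k₁) same-line sparse) dense
    ... | inj₂ (inj₂ (inj₁ e)) = contradiction (trans (sym same-line) e) off-t₁
    ... | inj₂ (inj₂ (inj₂ e)) = e

  cover : S ⊆ₛ sparsePart S k₁ ∪ (S ∩ line k₁ t₁)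
  cover v v∈S with sparse? S k₁ (k₁ v)
  ... | yes sparse = ∈-∪⁺ˡ (∈-sparsePart⁺ v∈S sparse)
  ... | no dense   = ∈-∪⁺ʳ (∈-∩⁺ v∈S (∈-line⁺ k₁ (dense⇒on-t₁ v∈S dense)))

denseCore : VSet n → (V n → Fin n) → (V n → Fin n) → VSet n
denseCore S k₁ k₂ = S ∩ ∁ (sparsePart S k₁) ∩ ∁ (sparsePart S k₂)

card-denseCore : ∀ (S : VSet n) k₁ k₂ → ∣ S ∣ ≤ n * 2 + (n * 2 + ∣ denseCore S k₁ k₂ ∣)
card-denseCore S k₁ k₂ = ≤-trans (card-mono cover)
  (card-∪ (card-sparsePart S k₁) (card-∪ (card-sparsePart S k₂) ≤-refl))
  where
  cover : S ⊆ₛ sparsePart S k₁ ∪ sparsePart S k₂ ∪ denseCore S k₁ k₂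
  cover v v∈S with v ∈? sparsePart S k₁ | v ∈? sparsePart S k₂
  ... | inj₁ p | _      = ∈-∪⁺ˡ p
  ... | inj₂ _ | inj₁ q = ∈-∪⁺ʳ (∈-∪⁺ˡ q)
  ... | inj₂ p | inj₂ q = ∈-∪⁺ʳ (∈-∪⁺ʳ (∈-∩⁺ v∈S (∈-∩⁺ p q)))

-- The graphs G_n and G_n × G_n

bCoord dCoord : V n → Fin n
bCoord (_ , b , _ , _) = b
dCoord (_ , _ , _ , d) = d

part-injective : ∀ (D : VSet n) i j → JointlyInjective (part D i j) bCoord dCoord
part-injective D i j {_ , b , _ , d} {_ , b' , _ , d'} p q refl refl
  with _ , refl , refl ← ∈-part⁻ p | _ , refl , refl ← ∈-part⁻ q = refl

other : Fin 2 → Fin 2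
other zero       = suc zero
other (suc zero) = zero

other-≢ : ∀ a → other a ≢ a
other-≢ zero       ()
other-≢ (suc zero) ()

≢⇒other : ∀ {a a' : Fin 2} → a' ≢ a → a' ≡ other a
≢⇒other {zero}     {zero}     a'≢a = contradiction refl a'≢a
≢⇒other {zero}     {suc zero} _    = refl
≢⇒other {suc zero} {zero}     _    = refl
≢⇒other {suc zero} {suc zero} a'≢a = contradiction refl a'≢a

variable
  a a' : Fin 2

adjG-same : ∀ {b b' : Fin n} → b ≢ b' → AdjG (a , b) (a , b')
adjG-same b≢b' = inj₁ (refl , b≢b')

adjG-cross : ∀ {b : Fin n} → a ≢ a' → AdjG (a , b) (a' , b)
adjG-cross a≢a' = inj₂ (a≢a' , refl)

adjG-cross⁻ : ∀ {b b' : Fin n} → a ≢ a' → AdjG (a , b) (a' , b') → b ≡ b'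
adjG-cross⁻ a≢a' (inj₁ (a≡a' , _)) = contradiction a≡a' a≢a'
adjG-cross⁻ _    (inj₂ (_ , b≡b')) = b≡b'

adjG? : (p q : VG n) → Dec (AdjG p q)
adjG? (a , b) (a' , b') =
  ((a Fin.≟ a') ×-dec ¬? (b Fin.≟ b')) ⊎-dec (¬? (a Fin.≟ a') ×-dec (b Fin.≟ b'))

inClosedNbhd? : (v u : V n) → Dec (InClosedNbhd v u)
inClosedNbhd? (a , b , c , d) u@(a' , b' , c' , d') =
  (u ≟V (a , b , c , d)) ⊎-dec (adjG? (a , b) (a' , b') ×-dec adjG? (c , d) (c' , d'))

InClosedNbhd⇒Adj : ∀ {u v : V n} → u ≢ v → InClosedNbhd v u → Adj v u
InClosedNbhd⇒Adj u≢v (inj₁ u≡v) = contradiction u≡v u≢v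
InClosedNbhd⇒Adj _   (inj₂ v∼u) = v∼u

-- Private neighbors

variable
  D : VSet n
  u : V n

remove-other : ∀ (D : VSet n) → w ≢ v → remove D v w ≡ D w
remove-other {w = w} {v = v} D w≢v with w ≟V v
... | yes w≡v = contradiction w≡v w≢v
... | no _    = refl

remove-self : ∀ (D : VSet n) v → remove D v v ≡ false
remove-self D v with v ≟V v
... | yes _  = refl
... | no v≢v = contradiction refl v≢v

remove-⊆ : remove D v ⊆ₛ D
remove-⊆ {v = v} w p with w ≟V v | p
... | no _ | w∈D = w∈D

inNbhdSet? : (S : VSet n) (u : V n) → Dec (InNbhdSet S u)
inNbhdSet? {n} S u with any? (λ w → (S w ≟ᵇ true) ×-dec inClosedNbhd? w u) (allV n)
... | yes found = yes (satisfied found)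
... | no none   = no λ (w , w∈S , w∼u) → none (lose (∈-allV w) (w∈S , w∼u))

private-neighbor-exists : MinimalDominating D → v ∈ₛ D → ∃[ u ] PrivateNeighbor D v u
private-neighbor-exists {n} {D} {v} (dominating , minimal) v∈D
  with all? (inNbhdSet? (remove D v)) (allV n)
... | yes dominated
  with () ← trans (sym (remove-self D v))
              (minimal (remove D v) remove-⊆ (λ u → All.lookup dominated (∈-allV u)) v v∈D)
... | no ¬dominated
  with u , u∉N ← satisfied (¬All⇒Any¬ (inNbhdSet? (remove D v)) (allV n) ¬dominated)
  with w , w∈D , w∼u ← dominating u
  with w ≟V v
... | yes refl = u , w∼u , u∉N
... | no w≢v   = contradiction (w , trans (remove-other D w≢v) w∈D , w∼u) u∉N

PrivateNeighbor⇒¬Adj : PrivateNeighbor D v u → w ∈ₛ D → w ≢ v → ¬ Adj w u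
PrivateNeighbor⇒¬Adj {D = D} (_ , undominated) w∈D w≢v w∼u =
  undominated (_ , trans (remove-other D w≢v) w∈D , inj₂ w∼u)

large-part-avoids : ∀ {i j} (v : V n) (b' d' : Fin n) → 2 + (n + n) ≤ ∣ part D i j ∣ →
  ∃[ w ] (w ∈ₛ part D i j × w ≢ v × bCoord w ≢ b' × dCoord w ≢ d')
large-part-avoids {n} {D} {i} {j} v b' d' large =
  unpack (card-nonempty (+-cancelˡ-≤ (1 + (n + n)) 1 ∣ rest ∣ room))
  where
  P rest : VSet n
  P = part D i j
  rest = P ∩ ∁ ｛ v ｝ ∩ ∁ (line bCoord b') ∩ ∁ (line dCoord d')

  unpack : ∃[ w ] w ∈ₛ rest → ∃[ w ] (w ∈ₛ P × w ≢ v × bCoord w ≢ b' × dCoord w ≢ d')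
  unpack (w , p) with w∈P , p′ ← ∈-∩⁻ p with w∉v , p″ ← ∈-∩⁻ p′ with w∉b' , w∉d' ← ∈-∩⁻ p″ =
    w , w∈P , ∉-⟦⟧⁻ (_≟V v) w∉v , ∉-line⁻ bCoord w∉b' , ∉-line⁻ dCoord w∉d'

  cover : P ⊆ₛ ｛ v ｝ ∪ (P ∩ line bCoord b') ∪ (P ∩ line dCoord d') ∪ rest
  cover w w∈P with w ∈? ｛ v ｝ | w ∈? line bCoord b' | w ∈? line dCoord d'
  ... | inj₁ p | _      | _      = ∈-∪⁺ˡ p
  ... | inj₂ _ | inj₁ q | _      = ∈-∪⁺ʳ (∈-∪⁺ˡ (∈-∩⁺ w∈P q))
  ... | inj₂ _ | inj₂ _ | inj₁ r = ∈-∪⁺ʳ (∈-∪⁺ʳ (∈-∪⁺ˡ (∈-∩⁺ w∈P r)))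
  ... | inj₂ p | inj₂ q | inj₂ r = ∈-∪⁺ʳ (∈-∪⁺ʳ (∈-∪⁺ʳ (∈-∩⁺ w∈P (∈-∩⁺ p (∈-∩⁺ q r)))))

  room : (1 + (n + n)) + 1 ≤ (1 + (n + n)) + ∣ rest ∣
  room = begin
    (1 + (n + n)) + 1                      ≡⟨ +-comm (1 + (n + n)) 1 ⟩
    2 + (n + n)                            ≤⟨ large ⟩
    ∣ P ∣                                  ≤⟨ card-mono cover ⟩
    ∣ ｛ v ｝ ∪ (P ∩ line bCoord b') ∪ (P ∩ line dCoord d') ∪ rest ∣
      ≤⟨ card-∪ (card-singleton v) (card-∪ (card-line (part-injective D i j) b')
           (card-∪ (card-line (swap-injective (part-injective D i j)) d') ≤-refl)) ⟩
    1 + (n + (n + ∣ rest ∣))               ≡⟨ cong suc (+-assoc n n ∣ rest ∣) ⟨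
    (1 + (n + n)) + ∣ rest ∣               ∎
    where open ≤-Reasoning

no-private-neighbor-in-large-part : ∀ {D : VSet n} {i j} → 2 + (n + n) ≤ ∣ part D i j ∣ →
  InN i j u → ¬ PrivateNeighbor D v u
no-private-neighbor-in-large-part {u = _ , b' , _ , d'} {v = v} large (refl , refl) pn
  with w , w∈P , w≢v , e≢b' , f≢d' ← large-part-avoids v b' d' large
  with w∈D , refl , refl ← ∈-part⁻ w∈P
  = PrivateNeighbor⇒¬Adj pn w∈D w≢v (adjG-same e≢b' , adjG-same f≢d')

across-first⇒sparse : ∀ {D : VSet n} {a a' c} {b b' d d'} → a' ≢ a →
  PrivateNeighbor D (a , b , c , d) (a' , b' , c , d') → Sparse (part D a c) bCoord b
across-first⇒sparse {D = D} {a} {a'} {c} {b} {b'} {d} {d'} a'≢a pn@(v∼u , _)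
  with adj , _ ← InClosedNbhd⇒Adj (a'≢a ∘ cong proj₁) v∼u
  with refl ← adjG-cross⁻ (a'≢a ∘ sym) adj
  = card-pair (a , b , c , d) (a , b , c , d') on-pair
  where
  on-pair : ∀ w → w ∈ₛ part D a c ∩ line bCoord b → w ≡ (a , b , c , d) ⊎ w ≡ (a , b , c , d')
  on-pair (_ , _ , _ , f) p
    with w∈P , w∈line ← ∈-∩⁻ p
    with w∈D , refl , refl ← ∈-part⁻ w∈P | refl ← ∈-line⁻ bCoord w∈line
    with (a , b , c , f) ≟V (a , b , c , d) | f Fin.≟ d'
  ... | yes w≡v | _        = inj₁ w≡v
  ... | no _    | yes refl = inj₂ refl
  ... | no w≢v  | no f≢d'  = contradiction (adjG-cross (a'≢a ∘ sym) , adjG-same f≢d')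
                               (PrivateNeighbor⇒¬Adj pn w∈D w≢v)

across-second⇒sparse : ∀ {D : VSet n} {a c c'} {b b' d d'} → c' ≢ c →
  PrivateNeighbor D (a , b , c , d) (a , b' , c' , d') → Sparse (part D a c) dCoord d
across-second⇒sparse {D = D} {a} {c} {c'} {b} {b'} {d} {d'} c'≢c pn@(v∼u , _)
  with _ , adj ← InClosedNbhd⇒Adj (c'≢c ∘ cong (proj₁ ∘ proj₂ ∘ proj₂)) v∼u
  with refl ← adjG-cross⁻ (c'≢c ∘ sym) adj
  = card-pair (a , b , c , d) (a , b' , c , d) on-pair
  where
  on-pair : ∀ w → w ∈ₛ part D a c ∩ line dCoord d → w ≡ (a , b , c , d) ⊎ w ≡ (a , b' , c , d)
  on-pair (_ , e , _ , _) p
    with w∈P , w∈line ← ∈-∩⁻ p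
    with w∈D , refl , refl ← ∈-part⁻ w∈P | refl ← ∈-line⁻ dCoord w∈line
    with (a , e , c , d) ≟V (a , b , c , d) | e Fin.≟ b'
  ... | yes w≡v | _        = inj₁ w≡v
  ... | no _    | yes refl = inj₂ refl
  ... | no w≢v  | no e≢b'  = contradiction (adjG-same e≢b' , adjG-cross (c'≢c ∘ sym))
                               (PrivateNeighbor⇒¬Adj pn w∈D w≢v)

across-both⇒antipodal : ∀ {a a' c c'} {b b' d d' : Fin n} → a' ≢ a → c' ≢ c →
  InClosedNbhd (a , b , c , d) (a' , b' , c' , d') → (a' , b' , c' , d') ≡ (other a , b , other c , d)
across-both⇒antipodal a'≢a c'≢c v∼u
  with adj₁ , adj₂ ← InClosedNbhd⇒Adj (a'≢a ∘ cong proj₁) v∼u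
  with refl ← adjG-cross⁻ (a'≢a ∘ sym) adj₁ | refl ← adjG-cross⁻ (c'≢c ∘ sym) adj₂
  with refl ← ≢⇒other a'≢a | refl ← ≢⇒other c'≢c
  = refl

antipodal⇒aligned : ∀ {D : VSet n} {a c} {b d r s} →
  PrivateNeighbor D (a , b , c , d) (other a , b , other c , d) →
  (other a , r , other c , s) ∈ₛ D → b ≡ r ⊎ d ≡ s
antipodal⇒aligned {a = a} {b = b} {d = d} {r = r} {s = s} pn w∈D with b Fin.≟ r | d Fin.≟ s
... | yes b≡r | _       = inj₁ b≡r
... | no _    | yes d≡s = inj₂ d≡s
... | no b≢r  | no d≢s  = contradiction (adjG-same (b≢r ∘ sym) , adjG-same (d≢s ∘ sym))
                            (PrivateNeighbor⇒¬Adj pn w∈D (other-≢ a ∘ cong proj₁))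

private-neighbor-cases : ∀ {D : VSet n} {a c} {b d} {u} → PrivateNeighbor D (a , b , c , d) u →
    ∣ part D a c ∣ ≤ 1 + (n + n)
  ⊎ InN (other a) c u × Sparse (part D a c) bCoord b
  ⊎ InN a (other c) u × Sparse (part D a c) dCoord d
  ⊎ u ≡ (other a , b , other c , d)
private-neighbor-cases {n} {D} {a} {c} {u = a' , _ , c' , _} pn@(v∼u , _)
  with a' Fin.≟ a | c' Fin.≟ c
... | yes refl | yes refl with ∣ part D a c ∣ ≤? 1 + (n + n)
...   | yes small = inj₁ small
...   | no large  = contradiction pn (no-private-neighbor-in-large-part (≰⇒> large) (refl , refl))
private-neighbor-cases pn | no a'≢a | yes refl =
  inj₂ (inj₁ ((≢⇒other a'≢a , refl) , across-first⇒sparse a'≢a pn))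
private-neighbor-cases pn | yes refl | no c'≢c =
  inj₂ (inj₂ (inj₁ ((refl , ≢⇒other c'≢c) , across-second⇒sparse c'≢c pn)))
private-neighbor-cases (v∼u , _) | no a'≢a | no c'≢c =
  inj₂ (inj₂ (inj₂ (across-both⇒antipodal a'≢a c'≢c v∼u)))

-- The parts of D

off-diagonal-cases : ∀ {D : VSet n} {a c r s} → MinimalDominating D →
  (other a , r , other c , s) ∈ₛ D → v ∈ₛ part D a c → ∃[ u ] PrivateNeighbor D v u ×
    (∣ part D a c ∣ ≤ 1 + (n + n)
    ⊎ InN (other a) c u × Sparse (part D a c) bCoord (bCoord v)
    ⊎ InN a (other c) u × Sparse (part D a c) dCoord (dCoord v)
    ⊎ bCoord v ≡ r ⊎ dCoord v ≡ s)
off-diagonal-cases minimal w∈D v∈P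
  with v∈D , refl , refl ← ∈-part⁻ v∈P
  with u , pn ← private-neighbor-exists minimal v∈D
  with private-neighbor-cases pn
... | inj₁ small                       = u , pn , inj₁ small
... | inj₂ (inj₁ across-first)         = u , pn , inj₂ (inj₁ across-first)
... | inj₂ (inj₂ (inj₁ across-second)) = u , pn , inj₂ (inj₂ (inj₁ across-second))
... | inj₂ (inj₂ (inj₂ refl))          = _ , pn , inj₂ (inj₂ (inj₂ (antipodal⇒aligned pn w∈D)))

card-off-diagonal-≤6n : ∀ {D : VSet n} {a c r s} → MinimalDominating D →
  (other a , r , other c , s) ∈ₛ D → 1 ≤ n → ∣ part D a c ∣ ≤ 6 * n
card-off-diagonal-≤6n {D = D} {a} {c} minimal w∈D 1≤n =
  card-≤6n (part-injective D a c) 1≤n λ v v∈P →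
    Sum.map₂ (Sum.map proj₂ (Sum.map₁ proj₂)) (proj₂ (proj₂ (off-diagonal-cases minimal w∈D v∈P)))

card-part₁₀-≤3n : ∀ {D : VSet n} {r s} → MinimalDominating D → (zero , r , suc zero , s) ∈ₛ D →
  1 ≤ n → 2 + (n + n) ≤ ∣ part D zero zero ∣ → ∣ part D (suc zero) zero ∣ ≤ 3 * n
card-part₁₀-≤3n {D = D} minimal w∈D 1≤n large =
  card-≤3n (swap-injective (part-injective D (suc zero) zero)) 1≤n cases
  where
  cases : ∀ v → v ∈ₛ part D (suc zero) zero → _
  cases v v∈P with off-diagonal-cases minimal w∈D v∈P
  ... | _ , _  , inj₁ small                      = inj₁ small
  ... | _ , pn , inj₂ (inj₁ (u∈N₀₀ , _))        = contradiction pn (no-private-neighbor-in-large-part large u∈N₀₀)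
  ... | _ , _  , inj₂ (inj₂ (inj₁ (_ , sparse))) = inj₂ (inj₁ sparse)
  ... | _ , _  , inj₂ (inj₂ (inj₂ (inj₁ b≡r)))   = inj₂ (inj₂ (inj₂ b≡r))
  ... | _ , _  , inj₂ (inj₂ (inj₂ (inj₂ d≡s)))   = inj₂ (inj₂ (inj₁ d≡s))

card-part₀₁-≤3n : ∀ {D : VSet n} {r s} → MinimalDominating D → (suc zero , r , zero , s) ∈ₛ D →
  1 ≤ n → 2 + (n + n) ≤ ∣ part D zero zero ∣ → ∣ part D zero (suc zero) ∣ ≤ 3 * n
card-part₀₁-≤3n {D = D} minimal w∈D 1≤n large =
  card-≤3n (part-injective D zero (suc zero)) 1≤n cases
  where
  cases : ∀ v → v ∈ₛ part D zero (suc zero) → _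
  cases v v∈P with off-diagonal-cases minimal w∈D v∈P
  ... | _ , _  , inj₁ small                      = inj₁ small
  ... | _ , _  , inj₂ (inj₁ (_ , sparse))        = inj₂ (inj₁ sparse)
  ... | _ , pn , inj₂ (inj₂ (inj₁ (u∈N₀₀ , _)))  = contradiction pn (no-private-neighbor-in-large-part large u∈N₀₀)
  ... | _ , _  , inj₂ (inj₂ (inj₂ aligned))      = inj₂ (inj₂ aligned)

card-parts : ∀ {D : VSet n} → ¬ NonemptyPart D (suc zero) (suc zero) →
  ∣ D ∣ ≤ ∣ part D zero zero ∣ + (∣ part D (suc zero) zero ∣ + ∣ part D zero (suc zero) ∣)
card-parts {D = D} D₁₁=∅ = ≤-trans (card-mono cover) (card-∪ ≤-refl (card-∪ ≤-refl ≤-refl))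
  where
  cover : D ⊆ₛ part D zero zero ∪ part D (suc zero) zero ∪ part D zero (suc zero)
  cover (zero     , _ , zero     , _) v∈D = ∈-∪⁺ˡ (∈-part⁺ v∈D (refl , refl))
  cover (suc zero , _ , zero     , _) v∈D = ∈-∪⁺ʳ (∈-∪⁺ˡ (∈-part⁺ v∈D (refl , refl)))
  cover (zero     , _ , suc zero , _) v∈D = ∈-∪⁺ʳ (∈-∪⁺ʳ (∈-part⁺ v∈D (refl , refl)))
  cover (suc zero , _ , suc zero , _) v∈D = contradiction (_ , v∈D , refl , refl) D₁₁=∅

denseCore₀₀-private : ∀ {D : VSet n} → MinimalDominating D → 2 + (n + n) ≤ ∣ part D zero zero ∣ →
  v ∈ₛ denseCore (part D zero zero) bCoord dCoord →
  v ∈ₛ D × InN zero zero v × ∃[ u ] (InN (suc zero) (suc zero) u × PrivateNeighbor D v u)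
denseCore₀₀-private minimal large v∈core
  with v∈P , v∉sparse ← ∈-∩⁻ v∈core
  with v∉sparseᵇ , v∉sparseᵈ ← ∈-∩⁻ v∉sparse
  with v∈D , refl , refl ← ∈-part⁻ v∈P
  with u , pn ← private-neighbor-exists minimal v∈D
  with private-neighbor-cases pn
... | inj₁ small                      = contradiction large (<⇒≱ (s≤s small))
... | inj₂ (inj₁ (_ , sparse))        = contradiction (∈-sparsePart⁺ v∈P sparse) (∈-∁⁻ v∉sparseᵇ)
... | inj₂ (inj₂ (inj₁ (_ , sparse))) = contradiction (∈-sparsePart⁺ v∈P sparse) (∈-∁⁻ v∉sparseᵈ)
... | inj₂ (inj₂ (inj₂ refl))         = v∈D , (refl , refl) , _ , (refl , refl) , pn

first-summand-large : ∀ n {a b c} → 15 ≤ n → n * n < a + (b + c) → b ≤ 6 * n → c ≤ 6 * n →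
  2 + (n + n) ≤ a
first-summand-large n {a} {b} {c} 15≤n n²<a+b+c b≤6n c≤6n with 2 + (n + n) ≤? a
... | yes large = large
... | no ¬large = contradiction n²<a+b+c (≤⇒≯ (begin
  a + (b + c)                    ≤⟨ +-mono-≤ (≤-pred (≰⇒> ¬large)) (+-mono-≤ b≤6n c≤6n) ⟩
  1 + (n + n) + (6 * n + 6 * n)  ≡⟨ 14n n ⟩
  1 + 14 * n                     ≤⟨ +-monoˡ-≤ (14 * n) (≤-trans (s≤s z≤n) 15≤n) ⟩
  15 * n                         ≤⟨ *-monoˡ-≤ n 15≤n ⟩
  n * n                          ∎))
  where
  open ≤-Reasoning
  14n : ∀ n → 1 + (n + n) + (6 * n + 6 * n) ≡ 1 + 14 * n
  14n = solve-∀

remainder-large : ∀ n {a b c l} → n * n < a + (b + c) → a ≤ n * 2 + (n * 2 + l) →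
  b ≤ 3 * n → c ≤ 3 * n → n * n ∸ 10 * n ≤ l
remainder-large n {a} {b} {c} {l} n²<a+b+c a≤4n+l b≤3n c≤3n = begin
  n * n ∸ 10 * n                               ≤⟨ ∸-monoˡ-≤ (10 * n) (begin
      n * n                                    ≤⟨ <⇒≤ n²<a+b+c ⟩
      a + (b + c)                              ≤⟨ +-mono-≤ a≤4n+l (+-mono-≤ b≤3n c≤3n) ⟩
      n * 2 + (n * 2 + l) + (3 * n + 3 * n)    ≡⟨ 10n n l ⟩
      l + 10 * n                               ∎) ⟩
  l + 10 * n ∸ 10 * n                          ≡⟨ m+n∸n≡m l (10 * n) ⟩
  l                                            ∎
  where
  open ≤-Reasoning
  10n : ∀ n l → n * 2 + (n * 2 + l) + (3 * n + 3 * n) ≡ l + 10 * n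
  10n = solve-∀

lemma18 : (n : ℕ) → 71 ≤ n → (D : VSet n) → MinimalDominating D →
    card D > n * n →
    NonemptyPart D zero zero → NonemptyPart D (suc zero) zero →
    NonemptyPart D zero (suc zero) → ¬ NonemptyPart D (suc zero) (suc zero) →
    (∃[ L ] (Unique L × n * n ∸ 10 * n ≤ length L ×
      All (λ v → v ∈ₛ D × InN zero zero v ×
             ∃[ u ] (InN (suc zero) (suc zero) u × PrivateNeighbor D v u)) L))
    × (∀ (v u : V n) → v ∈ₛ D → InN zero zero u → ¬ PrivateNeighbor D v u)
lemma18 n 71≤n D minimal |D|>n² _ (_ , w₁₀∈D , refl , refl) (_ , w₀₁∈D , refl , refl) D₁₁=∅ =
  ( filterᵇ core (allV n)
  , filter⁺ (T? ∘ core) (allV-unique n)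
  , subst (n * n ∸ 10 * n ≤_) (∣∣≡card core)
      (remainder-large n (≤-trans n²<|D| (card-parts D₁₁=∅)) (card-denseCore A bCoord dCoord)
        (card-part₁₀-≤3n minimal w₀₁∈D 1≤n A-large) (card-part₀₁-≤3n minimal w₁₀∈D 1≤n A-large))
  , All.map (denseCore₀₀-private minimal A-large ∘ Equivalence.to T-≡) (all-filter (T? ∘ core) (allV n)))
  , λ _ _ _ → no-private-neighbor-in-large-part A-large
  where
  A core : VSet n
  A = part D zero zero
  core = denseCore A bCoord dCoord

  1≤n : 1 ≤ n
  1≤n = ≤-trans (s≤s z≤n) 71≤n

  n²<|D| : n * n < ∣ D ∣
  n²<|D| = subst (n * n <_) (sym (∣∣≡card D)) |D|>n²

  A-large : 2 + (n + n) ≤ ∣ A ∣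
  A-large = first-summand-large n (≤-trans (m≤m+n 15 56) 71≤n) (≤-trans n²<|D| (card-parts D₁₁=∅))
    (card-off-diagonal-≤6n minimal w₀₁∈D 1≤n) (card-off-diagonal-≤6n minimal w₁₀∈D 1≤n)
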